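{- If $\nu(m_1,w_1)\le n_1$ and $\nu(m_2,w_2)\le n_2$, then $\nu(m_1+m_2,w_1+w_2)\le n_1+n_2$.
   Context: For $y \in \{0,1\}^n$, $\mathrm{wt}(y)$ is the number of nonzero coordinates, and $\mathcal{B}(n,w)=\{y\in\{0,1\}^n : \mathrm{wt}(y)\le w\}$. A domination graph is a bipartite graph $G=([m]\cup[n],E)$ with left vertex set $[m]$ and right vertex set $[n]$ having no isolated right vertices. An injective map $\varphi:\{0,1\}^m\to\mathcal{B}(n,w)$ is $G$-dominating if for every $x\in\{0,1\}^m$ and every edge $(i,j)\in E$: $x_i=0$ implies that the $j$-th coordinate of $\varphi(x)$ is $0$. An $(m,n,w)$-domination mapping is an injective map $\{0,1\}^m\to\mathcal{B}(n,w)$ that is $G$-dominating for some domination graph $G=([m]\cup[n],E)$. $\nu(m,w)$ denotes the minimum integer $n$ such that an $(m,n,w)$-domination mapping exists. -}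

module Defs where

open import Data.Nat using (ℕ; _≤_; _+_)
open import Data.Bool using (Bool; true; false)
open import Data.Fin using (Fin)
open import Data.Vec using (Vec; lookup; count)
open import Data.Product using (Σ; ∃; _×_; _,_)
open import Relation.Binary.PropositionalEquality using (_≡_)
open import Function.Definitions using (Injective)
open import Relation.Nullary using (Dec; yes; no)

-- Binary vectors {0,1}^n, with true = 1, false = 0.
BinVec : ℕ → Set
BinVec n = Vec Bool n

isOne : (b : Bool) → Dec (b ≡ true)
isOne true = yes _≡_.refl
isOne false = no (λ ())

wt : ∀ {n} → BinVec n → ℕ
wt = count isOne

record DominationGraph (m n : ℕ) : Set₁ where
  field
    Edge         : Fin m → Fin n → Set
    noIsolated   : ∀ (j : Fin n) → ∃ λ (i : Fin m) → Edge i j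

IsDominating : ∀ {m n} → DominationGraph m n → (BinVec m → BinVec n) → Set
IsDominating {m} {n} G φ =
  ∀ (x : BinVec m) (i : Fin m) (j : Fin n) →
    DominationGraph.Edge G i j → lookup x i ≡ false → lookup (φ x) j ≡ false

DominationMapping : ℕ → ℕ → ℕ → Set₁
DominationMapping m n w =
  Σ (BinVec m → BinVec n) λ φ →
    Injective _≡_ _≡_ φ
    × (∀ x → wt (φ x) ≤ w)
    × Σ (DominationGraph m n) λ G → IsDominating G φ

-- "ν(m,w) ≤ n": the minimum n' admitting an (m,n',w)-domination mapping
-- is at most n, i.e. some n' ≤ n admits one.
νLe : ℕ → ℕ → ℕ → Set₁
νLe m w n = Σ ℕ λ n' → n' ≤ n × DominationMapping m n' w

module Submission where

-- Domination mappings compose under concatenation, so ν is subadditive.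
--
-- Given an (m₁,k₁,w₁)-domination mapping φ₁ (graph G₁) and an
-- (m₂,k₂,w₂)-domination mapping φ₂ (graph G₂), the map
--     (φ₁ ⊗ φ₂)(x) = φ₁(x[0..m₁)) ++ φ₂(x[m₁..m₁+m₂))
-- is an (m₁+m₂, k₁+k₂, w₁+w₂)-domination mapping for the disjoint union
-- G₁ ⊕ G₂ of the two graphs:
--   * it is injective since both halves are injective and ++ is injective;
--   * its weight is the sum of the weights of the halves (wt-++);
--   * an edge of G₁ ⊕ G₂ lies inside G₁ or inside G₂, and on each side the
--     domination condition is that of φ₁ resp. φ₂ (⊗-dominating).
-- The theorem follows: if k₁ ≤ n₁ and k₂ ≤ n₂ witness ν(m₁,w₁) ≤ n₁ and
-- ν(m₂,w₂) ≤ n₂, then k₁ + k₂ ≤ n₁ + n₂ witnesses the claim for the sums.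

open import Defs
open import Data.Nat using (ℕ; _+_; suc; _≤_)
open import Data.Nat.Properties using (+-mono-≤)
open import Data.Bool using (true; false)
open import Data.Fin using (Fin; splitAt; _↑ˡ_; _↑ʳ_)
open import Data.Fin.Properties using (splitAt-↑ˡ; splitAt-↑ʳ)
open import Data.Vec using (Vec; []; _∷_; lookup; _++_; take; drop)
open import Data.Vec.Properties using (take++drop≡id; lookup-splitAt; ++-injective)
open import Data.Product using (∃; _,_)
open import Data.Sum using (_⊎_; inj₁; inj₂; [_,_]′)
open import Data.Empty using (⊥)
open import Relation.Binary.PropositionalEquality
  using (_≡_; refl; sym; trans; cong; cong₂; subst; module ≡-Reasoning)
open import Function.Definitions using (Injective)

wt-++ : ∀ {a b} (xs : BinVec a) (ys : BinVec b) → wt (xs ++ ys) ≡ wt xs + wt ys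
wt-++ []           ys = refl
wt-++ (true  ∷ xs) ys = cong suc (wt-++ xs ys)
wt-++ (false ∷ xs) ys = wt-++ xs ys

SumEdge : ∀ {m₁ m₂ k₁ k₂} → DominationGraph m₁ k₁ → DominationGraph m₂ k₂ →
          Fin m₁ ⊎ Fin m₂ → Fin k₁ ⊎ Fin k₂ → Set
SumEdge G₁ G₂ (inj₁ i) (inj₁ j) = DominationGraph.Edge G₁ i j
SumEdge G₁ G₂ (inj₂ i) (inj₂ j) = DominationGraph.Edge G₂ i j
SumEdge G₁ G₂ _        _        = ⊥

_⊕_ : ∀ {m₁ m₂ k₁ k₂} → DominationGraph m₁ k₁ → DominationGraph m₂ k₂ →
      DominationGraph (m₁ + m₂) (k₁ + k₂)
_⊕_ {m₁} {m₂} {k₁} {k₂} G₁ G₂ = record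
  { Edge       = λ i j → SumEdge G₁ G₂ (splitAt m₁ i) (splitAt k₁ j)
  ; noIsolated = λ j → neighbour (splitAt k₁ j)
  }
  where
  neighbour : (t : Fin k₁ ⊎ Fin k₂) → ∃ λ i → SumEdge G₁ G₂ (splitAt m₁ i) t
  neighbour (inj₁ j) with DominationGraph.noIsolated G₁ j
  ... | i , e = i ↑ˡ m₂ , subst (λ s → SumEdge G₁ G₂ s (inj₁ j)) (sym (splitAt-↑ˡ m₁ i m₂)) e
  neighbour (inj₂ j) with DominationGraph.noIsolated G₂ j
  ... | i , e = m₁ ↑ʳ i , subst (λ s → SumEdge G₁ G₂ s (inj₂ j)) (sym (splitAt-↑ʳ m₁ m₂ i)) e

_⊗_ : ∀ {m₁ m₂ k₁ k₂} → (BinVec m₁ → BinVec k₁) → (BinVec m₂ → BinVec k₂) →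
      BinVec (m₁ + m₂) → BinVec (k₁ + k₂)
_⊗_ {m₁} φ₁ φ₂ x = φ₁ (take m₁ x) ++ φ₂ (drop m₁ x)

⊗-injective : ∀ {m₁ m₂ k₁ k₂} {φ₁ : BinVec m₁ → BinVec k₁} {φ₂ : BinVec m₂ → BinVec k₂} →
              Injective _≡_ _≡_ φ₁ → Injective _≡_ _≡_ φ₂ → Injective _≡_ _≡_ (φ₁ ⊗ φ₂)
⊗-injective {m₁} {φ₁ = φ₁} φ₁-inj φ₂-inj {x} {y} eq
  with ++-injective (φ₁ (take m₁ x)) (φ₁ (take m₁ y)) eq
... | eq₁ , eq₂ = begin
  x                           ≡⟨ sym (take++drop≡id m₁ x) ⟩
  take m₁ x ++ drop m₁ x      ≡⟨ cong₂ _++_ (φ₁-inj eq₁) (φ₂-inj eq₂) ⟩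
  take m₁ y ++ drop m₁ y      ≡⟨ take++drop≡id m₁ y ⟩
  y                           ∎
  where open ≡-Reasoning

⊗-weight : ∀ {m₁ m₂ k₁ k₂ w₁ w₂} (φ₁ : BinVec m₁ → BinVec k₁) (φ₂ : BinVec m₂ → BinVec k₂) →
           (∀ x → wt (φ₁ x) ≤ w₁) → (∀ x → wt (φ₂ x) ≤ w₂) →
           ∀ x → wt ((φ₁ ⊗ φ₂) x) ≤ w₁ + w₂
⊗-weight {m₁} φ₁ φ₂ wt₁ wt₂ x
  rewrite wt-++ (φ₁ (take m₁ x)) (φ₂ (drop m₁ x)) = +-mono-≤ (wt₁ _) (wt₂ _)

lookup-blocks : ∀ {A : Set} m₁ {m₂} (x : Vec A (m₁ + m₂)) (i : Fin (m₁ + m₂)) →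
                lookup x i ≡ [ lookup (take m₁ x) , lookup (drop m₁ x) ]′ (splitAt m₁ i)
lookup-blocks m₁ x i = begin
  lookup x i                                 ≡⟨ cong (λ v → lookup v i) (sym (take++drop≡id m₁ x)) ⟩
  lookup (take m₁ x ++ drop m₁ x) i          ≡⟨ lookup-splitAt m₁ (take m₁ x) (drop m₁ x) i ⟩
  [ lookup (take m₁ x) , lookup (drop m₁ x) ]′ (splitAt m₁ i) ∎
  where open ≡-Reasoning

-- If φᵢ is Gᵢ-dominating then φ₁ ⊗ φ₂ is (G₁ ⊕ G₂)-dominating: an edge of the
-- union stays inside one block, where the corresponding φᵢ is dominating.
⊗-dominating : ∀ {m₁ m₂ k₁ k₂} {G₁ : DominationGraph m₁ k₁} {G₂ : DominationGraph m₂ k₂}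
               (φ₁ : BinVec m₁ → BinVec k₁) (φ₂ : BinVec m₂ → BinVec k₂) →
               IsDominating G₁ φ₁ → IsDominating G₂ φ₂ → IsDominating (G₁ ⊕ G₂) (φ₁ ⊗ φ₂)
⊗-dominating {m₁} {m₂} {k₁} {k₂} {G₁} {G₂} φ₁ φ₂ dom₁ dom₂ x i j e xᵢ≡0 =
  trans (lookup-splitAt k₁ (φ₁ xs) (φ₂ ys) j)
        (blockwise (splitAt m₁ i) (splitAt k₁ j) e (trans (sym (lookup-blocks m₁ x i)) xᵢ≡0))
  where
  xs = take m₁ x
  ys = drop m₁ x
  blockwise : (s : Fin m₁ ⊎ Fin m₂) (t : Fin k₁ ⊎ Fin k₂) → SumEdge G₁ G₂ s t →
              [ lookup xs , lookup ys ]′ s ≡ false →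
              [ lookup (φ₁ xs) , lookup (φ₂ ys) ]′ t ≡ false
  blockwise (inj₁ i) (inj₁ j) e = dom₁ xs i j e
  blockwise (inj₂ i) (inj₂ j) e = dom₂ ys i j e

combine : ∀ {m₁ k₁ w₁ m₂ k₂ w₂} →
          DominationMapping m₁ k₁ w₁ → DominationMapping m₂ k₂ w₂ →
          DominationMapping (m₁ + m₂) (k₁ + k₂) (w₁ + w₂)
combine (φ₁ , φ₁-inj , wt₁ , G₁ , dom₁) (φ₂ , φ₂-inj , wt₂ , G₂ , dom₂) =
  φ₁ ⊗ φ₂ , ⊗-injective φ₁-inj φ₂-inj , ⊗-weight φ₁ φ₂ wt₁ wt₂ , G₁ ⊕ G₂ , ⊗-dominating φ₁ φ₂ dom₁ dom₂

lemma12 : ∀ (m₁ w₁ n₁ m₂ w₂ n₂ : ℕ) →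
    νLe m₁ w₁ n₁ → νLe m₂ w₂ n₂ → νLe (m₁ + m₂) (w₁ + w₂) (n₁ + n₂)
lemma12 m₁ w₁ n₁ m₂ w₂ n₂ (k₁ , k₁≤n₁ , D₁) (k₂ , k₂≤n₂ , D₂) =
  k₁ + k₂ , +-mono-≤ k₁≤n₁ k₂≤n₂ , combine D₁ D₂
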